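{- Let $\Gamma_1,\dots,\Gamma_r$ be finite simple graphs with $G_i\le\mathrm{Aut}(\Gamma_i)$, let $\Gamma$ be their disjoint union and $G=G_1\times\cdots\times G_r$ acting on $\Gamma$ componentwise. Then $P_{\Gamma,G}(x)=\prod_{i=1}^rP_{\Gamma_i,G_i}(x)$. In particular, if $(\Gamma_i,G_i)$ is a reciprocal pair for each $i$, then $(\Gamma,G)$ is a reciprocal pair.
   Context: $F_G(x)=\sum_{g\in G}x^{c(g)}$, $c(g)$ the number of cycles of $g$ on vertices. For $g\in\mathrm{Aut}(\Gamma)$, $\Gamma/g$ has the cycles of $g$ as vertices, two (possibly equal, giving a loop) joined if an edge of $\Gamma$ joins vertices in them; $P_{\Gamma/g}$ is its chromatic polynomial ($0$ if there is a loop). $P_{\Gamma,G}(x)=\sum_{g\in G}P_{\Gamma/g}(x)$. $(\Gamma,G)$ is a reciprocal pair if $P_{\Gamma,G}(x)=(-1)^nF_G(-x)$, $n$ the number of vertices of $\Gamma$. -}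

module Defs where

open import Data.Bool using (Bool; true; false; not; _∧_; _∨_)
open import Data.Nat as ℕ using (ℕ; zero; suc; _≤ᵇ_)
open import Data.Fin as Fin using (Fin; toℕ; _↑ˡ_; _↑ʳ_; splitAt)
open import Data.Fin.Properties using (_≟_)
open import Data.Integer as ℤ using (ℤ; +_; -1ℤ)
open import Data.List using (List; []; _∷_; map; concatMap; length; filterᵇ; upTo; allFin; lookup)
open import Data.Bool.ListAction using (all; any)
open import Data.Nat.ListAction using (sum)
open import Data.List.Relation.Unary.All using (All)
open import Data.List.Relation.Unary.Any using (Any)
open import Data.List.Relation.Unary.AllPairs using (AllPairs)
open import Data.List.Membership.Propositional using (_∈_)
open import Data.Vec as Vec using (Vec)
open import Data.Sum using ([_,_]′; inj₁; inj₂)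
open import Data.Product using (_×_)
open import Function using (_∘_; id)
open import Function.Definitions using (Bijective)
open import Relation.Binary.PropositionalEquality using (_≡_; _≗_)
open import Relation.Nullary using (¬_)
open import Relation.Nullary.Decidable using (⌊_⌋)

Graph : ℕ → Set
Graph n = Fin n → Fin n → Bool

IsSimple : ∀ {n} → Graph n → Set
IsSimple {n} Γ = (∀ (u v : Fin n) → Γ u v ≡ Γ v u) × (∀ (v : Fin n) → Γ v v ≡ false)

Map : ℕ → Set
Map n = Fin n → Fin n

IsAut : ∀ {n} → Graph n → Map n → Set
IsAut Γ g = Bijective _≡_ _≡_ g × (∀ u v → Γ (g u) (g v) ≡ Γ u v)

IsAutSubgroup : ∀ {n} → Graph n → List (Map n) → Set
IsAutSubgroup {n} Γ G =
  All (IsAut Γ) G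
  × Any (λ e → e ≗ id) G
  × (∀ g h → g ∈ G → h ∈ G → Any (λ k → k ≗ g ∘ h) G)
  × (∀ g → g ∈ G → Any (λ k → k ∘ g ≗ id) G)
  × AllPairs (λ g h → ¬ (g ≗ h)) G

iter : ∀ {n} → Map n → ℕ → Fin n → Fin n
iter g zero    v = v
iter g (suc k) v = g (iter g k v)

-- the cycle of g through v (g^k v for k < n; this is the whole cycle)
orbit : ∀ {n} → Map n → Fin n → List (Fin n)
orbit {n} g v = map (λ k → iter g k v) (upTo n)

isRep : ∀ {n} → Map n → Fin n → Bool
isRep g v = all (λ w → toℕ v ≤ᵇ toℕ w) (orbit g v)

reps : ∀ {n} → Map n → List (Fin n)
reps {n} g = filterᵇ (isRep g) (allFin n)

c : ∀ {n} → Map n → ℕ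
c g = length (reps g)

inCycle : ∀ {n} → Map n → Fin n → Fin n → Bool
inCycle g r u = any (λ w → ⌊ w ≟ r ⌋) (orbit g u)

-- the quotient graph Γ/g: vertices are the cycles of g (indexed by
-- Fin (c g)); two cycles (possibly equal: a loop) are adjacent iff some
-- edge of Γ joins vertices in them.
quotient : ∀ {n} → Graph n → (g : Map n) → Graph (c g)
quotient {n} Γ g i j =
  any (λ u → any (λ w → Γ u w ∧ inCycle g (lookup (reps g) i) u
                                ∧ inCycle g (lookup (reps g) j) w)
                 (allFin n))
      (allFin n)

-- Chromatic polynomial (evaluated at x ∈ ℕ): number of proper colourings
-- with x colours.  A loop forbids every colouring, so this is 0 then.

allColourings : (m x : ℕ) → List (Vec (Fin x) m)
allColourings zero    x = Vec.[] ∷ []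
allColourings (suc m) x =
  concatMap (λ a → map (a Vec.∷_) (allColourings m x)) (allFin x)

isProper : ∀ {m x} → Graph m → Vec (Fin x) m → Bool
isProper {m} A f =
  all (λ i → all (λ j → not (A i j) ∨ not ⌊ Vec.lookup f i ≟ Vec.lookup f j ⌋)
                 (allFin m))
      (allFin m)

chrom : ∀ {m} → Graph m → ℕ → ℕ
chrom {m} A x = length (filterᵇ (isProper A) (allColourings m x))

P : ∀ {n} → Graph n → List (Map n) → ℕ → ℕ
P Γ G x = sum (map (λ g → chrom (quotient Γ g) x) G)

F : ∀ {n} → List (Map n) → ℤ → ℤ
F G y = sum′ (map (λ g → y ℤ.^ c g) G)
  where
  sum′ : List ℤ → ℤ
  sum′ []       = + 0
  sum′ (a ∷ as) = a ℤ.+ sum′ as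

-- reciprocal pair: P_{Γ,G}(x) = (-1)^n F_G(-x) as polynomials, i.e. for
-- every x ∈ ℕ (a polynomial over ℤ is determined by its values on ℕ).
Reciprocal : ∀ {n} → Graph n → List (Map n) → Set
Reciprocal {n} Γ G = ∀ (x : ℕ) → + (P Γ G x) ≡ (-1ℤ ℤ.^ n) ℤ.* F G (ℤ.- (+ x))

record Comp : Set where
  constructor comp
  field
    size  : ℕ
    graph : Graph size
    group : List (Map size)
open Comp public

_⊕G_ : ∀ {m k} → Graph m → Graph k → Graph (m ℕ.+ k)
_⊕G_ {m} {k} Γ Δ u v with splitAt m u | splitAt m v
... | inj₁ a | inj₁ b = Γ a b
... | inj₂ a | inj₂ b = Δ a b
... | inj₁ _ | inj₂ _ = false
... | inj₂ _ | inj₁ _ = false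

_⊕M_ : ∀ {m k} → Map m → Map k → Map (m ℕ.+ k)
_⊕M_ {m} {k} g h v = [ (λ a → g a ↑ˡ k) , (λ b → m ↑ʳ h b) ]′ (splitAt m v)

_⊗_ : ∀ {m k} → List (Map m) → List (Map k) → List (Map (m ℕ.+ k))
G ⊗ H = concatMap (λ g → map (λ h → g ⊕M h) H) G

emptyGraph : Graph 0
emptyGraph ()

union : List Comp → Comp
union []       = comp 0 emptyGraph (id ∷ [])
union (C ∷ Cs) = comp (size C ℕ.+ size (union Cs))
                      (graph C ⊕G graph (union Cs))
                      (group C ⊗ group (union Cs))

-- The cycles of (g, h) acting on Γ ⊔ Δ are the cycles of g together with those of h; this
-- needs only that the iterates g⁰v, …, gᵐv of a map of an m-element set already contain every gⁿv
-- (pigeonhole).  Hence c(g, h) = c(g) + c(h), and (Γ ⊔ Δ)/(g, h) is Γ/g ⊔ Δ/h, because no edge and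
-- no cycle crosses between the components.  Proper colourings of a disjoint union are pairs of proper
-- colourings, so P_{Γ⊔Δ/(g,h)} = P_{Γ/g} P_{Δ/h}; summing a product weight over G × H factorises,
-- giving P_{Γ⊔Δ,G×H} = P_{Γ,G} P_{Δ,H} and F_{G×H} = F_G F_H, while (-1)^(m+k) = (-1)^m (-1)^k.

module Submission where

open import Defs
open import Data.Nat using (ℕ)
open import Data.List using (List; map)
open import Data.Nat.ListAction using (product)
open import Data.List.Relation.Unary.All using (All)
open import Data.Product using (_×_)
open import Relation.Binary.PropositionalEquality using (_≡_)

open import Algebra.Bundles using (Semiring)
open import Data.List using ([]; _∷_; _++_; foldr; concatMap)
open import Data.List.Properties using (map-++)
open import Relation.Binary.PropositionalEquality using (cong)
import Relation.Binary.Reasoning.Setoid as SetoidReasoning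

module SemiringSum {c ℓ} (R : Semiring c ℓ) where

  open Semiring R
  open SetoidReasoning setoid

  Σ : List Carrier → Carrier
  Σ = foldr _+_ 0#

  Σ-map-*ʳ : ∀ {A : Set} a (φ : A → Carrier) xs → Σ (map (λ x → φ x * a) xs) ≈ Σ (map φ xs) * a
  Σ-map-*ʳ a φ []       = sym (zeroˡ a)
  Σ-map-*ʳ a φ (x ∷ xs) = begin
    φ x * a + Σ (map (λ x → φ x * a) xs) ≈⟨ +-congˡ (Σ-map-*ʳ a φ xs) ⟩
    φ x * a + Σ (map φ xs) * a           ≈⟨ distribʳ a (φ x) _ ⟨
    (φ x + Σ (map φ xs)) * a             ∎

  Σ-++ : ∀ xs ys → Σ (xs ++ ys) ≈ Σ xs + Σ ys
  Σ-++ []       ys = sym (+-identityˡ (Σ ys))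
  Σ-++ (x ∷ xs) ys = trans (+-congˡ (Σ-++ xs ys)) (sym (+-assoc x (Σ xs) (Σ ys)))

  Σ-cartesian : ∀ {A B C : Set} (f : A → B → C) (φ : C → Carrier) (φ₁ : A → Carrier) (φ₂ : B → Carrier) →
    (∀ a b → φ (f a b) ≈ φ₁ a * φ₂ b) →
    ∀ xs ys → Σ (map φ (concatMap (λ a → map (f a) ys) xs)) ≈ Σ (map φ₁ xs) * Σ (map φ₂ ys)
  Σ-cartesian f φ φ₁ φ₂ split []       ys = sym (zeroˡ _)
  Σ-cartesian f φ φ₁ φ₂ split (x ∷ xs) ys = begin
    Σ (map φ (map (f x) ys ++ rest))
      ≈⟨ reflexive (cong Σ (map-++ φ (map (f x) ys) rest)) ⟩
    Σ (map φ (map (f x) ys) ++ map φ rest)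
      ≈⟨ Σ-++ (map φ (map (f x) ys)) (map φ rest) ⟩
    Σ (map φ (map (f x) ys)) + Σ (map φ rest)
      ≈⟨ +-cong (row ys) (Σ-cartesian f φ φ₁ φ₂ split xs ys) ⟩
    φ₁ x * Σ (map φ₂ ys) + Σ (map φ₁ xs) * Σ (map φ₂ ys)
      ≈⟨ distribʳ (Σ (map φ₂ ys)) (φ₁ x) (Σ (map φ₁ xs)) ⟨
    (φ₁ x + Σ (map φ₁ xs)) * Σ (map φ₂ ys) ∎
    where
    rest = concatMap (λ a → map (f a) ys) xs
    row : ∀ zs → Σ (map φ (map (f x) zs)) ≈ φ₁ x * Σ (map φ₂ zs)
    row []       = sym (zeroʳ (φ₁ x))
    row (z ∷ zs) = begin
      φ (f x z) + Σ (map φ (map (f x) zs)) ≈⟨ +-cong (split x z) (row zs) ⟩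
      φ₁ x * φ₂ z + φ₁ x * Σ (map φ₂ zs)  ≈⟨ distribˡ (φ₁ x) (φ₂ z) _ ⟨
      φ₁ x * (φ₂ z + Σ (map φ₂ zs))        ∎

-- Opened only here: SemiringSum's _+_ and _*_ would clash with those of ℕ.
open import Data.Bool using (Bool; true; false; not; _∧_; _∨_; T)
open import Data.Bool.ListAction using (any; all; or; and)
open import Data.Bool.Properties using (∨-assoc; ∧-assoc; ∨-identityʳ; ∧-identityʳ; ∧-zeroʳ)
open import Data.Empty using (⊥-elim)
import Data.Fin as Fin
open import Data.Fin using (Fin; toℕ; _↑ˡ_; _↑ʳ_; splitAt; cast)
open import Data.Fin.Properties
  using (_≟_; pigeonhole; toℕ<n; splitAt-↑ˡ; splitAt-↑ʳ; toℕ-↑ˡ; toℕ-↑ʳ; ↑ˡ-injective; ↑ʳ-injective;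
         cast-is-id)
open import Data.Integer using (-1ℤ)
import Data.Integer as ℤ
import Data.Integer.Properties as ℤ
open import Data.List using (upTo; allFin; tabulate; filterᵇ; length; lookup)
open import Data.List.Membership.Propositional using (_∈_)
open import Data.List.Membership.Propositional.Properties using (∈-map⁺; ∈-map⁻; ∈-upTo⁺; ∈-upTo⁻)
open import Data.List.Properties using (map-∘; map-cong; map-tabulate; filter-++; length-++; length-map)
open import Data.List.Relation.Binary.Subset.Propositional using (_⊆_)
open import Data.List.Relation.Binary.Subset.Propositional.Properties using (Any-resp-⊆; All-resp-⊇)
open import Data.List.Relation.Unary.All using ([]; _∷_)
open import Data.List.Relation.Unary.All.Properties using (all⁺; all⁻)
open import Data.List.Relation.Unary.Any.Properties using (any⁺; any⁻)
open import Data.Nat using (zero; suc; _+_; _*_; _∸_; _<_; _≤_; _<?_; _≤ᵇ_)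
open import Data.Nat.Induction using (<-rec)
open import Data.Nat.ListAction using (sum)
import Data.Nat.Properties as ℕ
open import Data.Nat.Properties
  using (≤-refl; ≤-pred; ≤-trans; <-≤-trans; ≮⇒≥; m∸n+n≡m; +-monoʳ-<; ≤ᵇ⇒≤; ≤⇒≤ᵇ; +-cancelˡ-≤; +-monoʳ-≤;
         m≤m+n; m≤n+m)
open import Data.Product using (_,_; ∃; ∃₂)
open import Data.Sum using (inj₁; inj₂; _⊎_; [_,_]′)
open import Data.Sum.Properties using ([,]-map)
open import Data.Unit using (tt)
open import Data.Vec as Vec using (Vec)
open import Data.Vec.Properties using (lookup-++ˡ; lookup-++ʳ)
open import Function using (_∘_; id)
open import Relation.Binary.PropositionalEquality using (refl; sym; trans; cong₂; subst; module ≡-Reasoning)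
open import Relation.Nullary using (yes; no; ¬_)
open import Relation.Nullary.Decidable using (⌊_⌋; toWitness; fromWitness)
open import Relation.Nullary.Decidable.Core using (T?)
open import Algebra.Properties.CommutativeSemigroup ℤ.*-commutativeSemigroup using (interchange)

T-ext : ∀ {a b} → (T a → T b) → (T b → T a) → a ≡ b
T-ext {false} {false} _ _ = refl
T-ext {false} {true}  _ g = ⊥-elim (g tt)
T-ext {true}  {false} f _ = ⊥-elim (f tt)
T-ext {true}  {true}  _ _ = refl

⌊≟⌋-injective : ∀ {n n′} (f : Fin n → Fin n′) → (∀ a b → f a ≡ f b → a ≡ b) →
                ∀ a b → ⌊ f a ≟ f b ⌋ ≡ ⌊ a ≟ b ⌋
⌊≟⌋-injective f f-inj a b = T-ext (λ t → fromWitness (f-inj a b (toWitness t)))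
                                  (λ t → fromWitness (cong f (toWitness t)))

⌊≟⌋-false : ∀ {n} {a b : Fin n} → ¬ (a ≡ b) → ⌊ a ≟ b ⌋ ≡ false
⌊≟⌋-false a≢b = T-ext (λ t → ⊥-elim (a≢b (toWitness t))) λ ()

↑ˡ≢↑ʳ : ∀ {m k} (i : Fin m) (j : Fin k) → ¬ (i ↑ˡ k ≡ m ↑ʳ j)
↑ˡ≢↑ʳ {m} {k} i j eq with () ← trans (sym (splitAt-↑ˡ m i k)) (trans (cong (splitAt m) eq) (splitAt-↑ʳ m k j))

+-cancelˡ-≤ᵇ : ∀ m a b → (m + a ≤ᵇ m + b) ≡ (a ≤ᵇ b)
+-cancelˡ-≤ᵇ m a b = T-ext (λ t → ≤⇒≤ᵇ (+-cancelˡ-≤ m a b (≤ᵇ⇒≤ (m + a) (m + b) t)))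
                           (λ t → ≤⇒≤ᵇ (+-monoʳ-≤ m (≤ᵇ⇒≤ a b t)))

module _ {A : Set} where

  any-++ : ∀ (p : A → Bool) xs ys → any p (xs ++ ys) ≡ any p xs ∨ any p ys
  any-++ p []       ys = refl
  any-++ p (x ∷ xs) ys = trans (cong (p x ∨_) (any-++ p xs ys)) (sym (∨-assoc (p x) _ _))

  all-++ : ∀ (p : A → Bool) xs ys → all p (xs ++ ys) ≡ all p xs ∧ all p ys
  all-++ p []       ys = refl
  all-++ p (x ∷ xs) ys = trans (cong (p x ∧_) (all-++ p xs ys)) (sym (∧-assoc (p x) _ _))

  any-cong : ∀ {p q : A → Bool} → (∀ x → p x ≡ q x) → ∀ xs → any p xs ≡ any q xs
  any-cong e xs = cong or (map-cong e xs)

  all-cong : ∀ {p q : A → Bool} → (∀ x → p x ≡ q x) → ∀ xs → all p xs ≡ all q xs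
  all-cong e xs = cong and (map-cong e xs)

  any-false : ∀ {p : A → Bool} → (∀ x → p x ≡ false) → ∀ xs → any p xs ≡ false
  any-false e []       = refl
  any-false e (x ∷ xs) rewrite e x = any-false e xs

  all-true : ∀ {p : A → Bool} → (∀ x → p x ≡ true) → ∀ xs → all p xs ≡ true
  all-true e []       = refl
  all-true e (x ∷ xs) rewrite e x = all-true e xs

  any-resp-⊆ : ∀ (p : A → Bool) {xs ys} → xs ⊆ ys → T (any p xs) → T (any p ys)
  any-resp-⊆ p {xs} xs⊆ys = any⁺ p ∘ Any-resp-⊆ xs⊆ys ∘ any⁻ p xs

  all-resp-⊇ : ∀ (p : A → Bool) {xs ys} → ys ⊆ xs → T (all p xs) → T (all p ys)
  all-resp-⊇ p {xs} ys⊆xs = all⁻ p ∘ All-resp-⊇ ys⊆xs ∘ all⁺ p xs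

module _ {A B : Set} where

  any-map : ∀ (p : B → Bool) (f : A → B) xs → any p (map f xs) ≡ any (p ∘ f) xs
  any-map p f xs = cong or (sym (map-∘ xs))

  all-map : ∀ (p : B → Bool) (f : A → B) xs → all p (map f xs) ≡ all (p ∘ f) xs
  all-map p f xs = cong and (sym (map-∘ xs))

  filterᵇ-map : ∀ (p : B → Bool) (f : A → B) xs → filterᵇ p (map f xs) ≡ map f (filterᵇ (p ∘ f) xs)
  filterᵇ-map p f []       = refl
  filterᵇ-map p f (x ∷ xs) with p (f x)
  ... | true  = cong (f x ∷_) (filterᵇ-map p f xs)
  ... | false = filterᵇ-map p f xs

filterᵇ-cong : ∀ {A : Set} {p q : A → Bool} → (∀ x → p x ≡ q x) → ∀ xs → filterᵇ p xs ≡ filterᵇ q xs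
filterᵇ-cong e []       = refl
filterᵇ-cong {p = p} {q} e (x ∷ xs) with p x | q x | e x
... | true  | true  | refl = cong (x ∷_) (filterᵇ-cong e xs)
... | false | false | refl = filterᵇ-cong e xs

count : ∀ {A : Set} → (A → Bool) → List A → ℕ
count p xs = length (filterᵇ p xs)

count-++ : ∀ {A : Set} (p : A → Bool) xs ys → count p (xs ++ ys) ≡ count p xs + count p ys
count-++ p xs ys = trans (cong length (filter-++ (T? ∘ p) xs ys)) (length-++ (filterᵇ p xs))

count-cong : ∀ {A : Set} {p q : A → Bool} → (∀ x → p x ≡ q x) → ∀ xs → count p xs ≡ count q xs
count-cong e xs = cong length (filterᵇ-cong e xs)

count-false : ∀ {A : Set} {p : A → Bool} → (∀ x → p x ≡ false) → ∀ xs → count p xs ≡ 0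
count-false e []       = refl
count-false e (x ∷ xs) rewrite e x = count-false e xs

count-map : ∀ {A B : Set} (p : B → Bool) (f : A → B) xs → count p (map f xs) ≡ count (p ∘ f) xs
count-map p f xs = trans (cong length (filterᵇ-map p f xs)) (length-map f (filterᵇ (p ∘ f) xs))

count-concatMap : ∀ {A B : Set} (p : B → Bool) (f : A → List B) xs →
  count p (concatMap f xs) ≡ sum (map (count p ∘ f) xs)
count-concatMap p f []       = refl
count-concatMap p f (x ∷ xs) = trans (count-++ p (f x) (concatMap f xs)) (cong (count p (f x) +_) (count-concatMap p f xs))

count-const-∧ : ∀ {A B : Set} (p : A → Bool) a (q : B → Bool) ys →
  count (λ y → p a ∧ q y) ys ≡ count p (a ∷ []) * count q ys
count-const-∧ p a q ys with p a
... | true  = sym (ℕ.+-identityʳ (count q ys))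
... | false = count-false (λ _ → refl) ys

lookup-map : ∀ {A B : Set} (f : A → B) xs (i : Fin (length (map f xs))) →
  lookup (map f xs) i ≡ f (lookup xs (cast (length-map f xs) i))
lookup-map f (x ∷ xs) Fin.zero    = refl
lookup-map f (x ∷ xs) (Fin.suc i) = lookup-map f xs i

length-map-++ : ∀ {A B C : Set} (L : A → C) (R : B → C) xs ys →
  length (map L xs ++ map R ys) ≡ length xs + length ys
length-map-++ L R xs ys = trans (length-++ (map L xs)) (cong₂ _+_ (length-map L xs) (length-map R ys))

lookup-map-++ : ∀ {A B C : Set} (L : A → C) (R : B → C) xs ys (i : Fin (length (map L xs ++ map R ys))) →
  lookup (map L xs ++ map R ys) i
  ≡ [ L ∘ lookup xs , R ∘ lookup ys ]′ (splitAt (length xs) (cast (length-map-++ L R xs ys) i))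
lookup-map-++ L R []       ys i           = lookup-map R ys i
lookup-map-++ L R (x ∷ xs) ys Fin.zero    = refl
lookup-map-++ L R (x ∷ xs) ys (Fin.suc i) =
  trans (lookup-map-++ L R xs ys i) (sym ([,]-map (splitAt (length xs) (cast (length-map-++ L R xs ys) i))))

tabulate-+ : ∀ {A : Set} m k (f : Fin (m + k) → A) →
             tabulate f ≡ tabulate (f ∘ (_↑ˡ k)) ++ tabulate (f ∘ (m ↑ʳ_))
tabulate-+ zero    k f = refl
tabulate-+ (suc m) k f = cong (f Fin.zero ∷_) (tabulate-+ m k (f ∘ Fin.suc))

allFin-+ : ∀ m k → allFin (m + k) ≡ map (_↑ˡ k) (allFin m) ++ map (m ↑ʳ_) (allFin k)
allFin-+ m k = trans (tabulate-+ m k id)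
  (sym (cong₂ _++_ (map-tabulate id (_↑ˡ k)) (map-tabulate id (m ↑ʳ_))))

module _ (m k : ℕ) where

  any-allFin-+ : ∀ (p : Fin (m + k) → Bool) →
    any p (allFin (m + k)) ≡ any (p ∘ (_↑ˡ k)) (allFin m) ∨ any (p ∘ (m ↑ʳ_)) (allFin k)
  any-allFin-+ p = begin
    any p (allFin (m + k))
      ≡⟨ cong (any p) (allFin-+ m k) ⟩
    any p (map (_↑ˡ k) (allFin m) ++ map (m ↑ʳ_) (allFin k))
      ≡⟨ any-++ p (map (_↑ˡ k) (allFin m)) (map (m ↑ʳ_) (allFin k)) ⟩
    any p (map (_↑ˡ k) (allFin m)) ∨ any p (map (m ↑ʳ_) (allFin k))
      ≡⟨ cong₂ _∨_ (any-map p _ (allFin m)) (any-map p _ (allFin k)) ⟩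
    any (p ∘ (_↑ˡ k)) (allFin m) ∨ any (p ∘ (m ↑ʳ_)) (allFin k) ∎
    where open ≡-Reasoning

  all-allFin-+ : ∀ (p : Fin (m + k) → Bool) →
    all p (allFin (m + k)) ≡ all (p ∘ (_↑ˡ k)) (allFin m) ∧ all (p ∘ (m ↑ʳ_)) (allFin k)
  all-allFin-+ p = begin
    all p (allFin (m + k))
      ≡⟨ cong (all p) (allFin-+ m k) ⟩
    all p (map (_↑ˡ k) (allFin m) ++ map (m ↑ʳ_) (allFin k))
      ≡⟨ all-++ p (map (_↑ˡ k) (allFin m)) (map (m ↑ʳ_) (allFin k)) ⟩
    all p (map (_↑ˡ k) (allFin m)) ∧ all p (map (m ↑ʳ_) (allFin k))
      ≡⟨ cong₂ _∧_ (all-map p _ (allFin m)) (all-map p _ (allFin k)) ⟩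
    all (p ∘ (_↑ˡ k)) (allFin m) ∧ all (p ∘ (m ↑ʳ_)) (allFin k) ∎
    where open ≡-Reasoning

any² : ∀ n → (Fin n → Fin n → Bool) → Bool
any² n M = any (λ i → any (M i) (allFin n)) (allFin n)

all² : ∀ n → (Fin n → Fin n → Bool) → Bool
all² n M = all (λ i → all (M i) (allFin n)) (allFin n)

module _ {n : ℕ} {M N : Fin n → Fin n → Bool} where

  any²-cong : (∀ i j → M i j ≡ N i j) → any² n M ≡ any² n N
  any²-cong e = any-cong (λ i → any-cong (e i) (allFin n)) (allFin n)

  all²-cong : (∀ i j → M i j ≡ N i j) → all² n M ≡ all² n N
  all²-cong e = all-cong (λ i → all-cong (e i) (allFin n)) (allFin n)

any²-false : ∀ {n} {M : Fin n → Fin n → Bool} → (∀ i j → M i j ≡ false) → any² n M ≡ false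
any²-false {n} e = any-false (λ i → any-false (e i) (allFin n)) (allFin n)

module _ (m k : ℕ) (M : Fin (m + k) → Fin (m + k) → Bool) where

  any²-blockDiagonal :
    (∀ i j → M (i ↑ˡ k) (m ↑ʳ j) ≡ false) → (∀ i j → M (m ↑ʳ i) (j ↑ˡ k) ≡ false) →
    any² (m + k) M ≡ any² m (λ i j → M (i ↑ˡ k) (j ↑ˡ k)) ∨ any² k (λ i j → M (m ↑ʳ i) (m ↑ʳ j))
  any²-blockDiagonal upper lower =
    trans (any-allFin-+ m k _) (cong₂ _∨_ (any-cong rowˡ (allFin m)) (any-cong rowʳ (allFin k)))
    where
    rowˡ : ∀ i → any (M (i ↑ˡ k)) (allFin (m + k)) ≡ any (λ j → M (i ↑ˡ k) (j ↑ˡ k)) (allFin m)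
    rowˡ i = trans (any-allFin-+ m k _)
      (trans (cong (any (λ j → M (i ↑ˡ k) (j ↑ˡ k)) (allFin m) ∨_) (any-false (upper i) (allFin k)))
             (∨-identityʳ _))
    rowʳ : ∀ i → any (M (m ↑ʳ i)) (allFin (m + k)) ≡ any (λ j → M (m ↑ʳ i) (m ↑ʳ j)) (allFin k)
    rowʳ i = trans (any-allFin-+ m k _)
      (cong (_∨ any (λ j → M (m ↑ʳ i) (m ↑ʳ j)) (allFin k)) (any-false (lower i) (allFin m)))

  all²-blockDiagonal :
    (∀ i j → M (i ↑ˡ k) (m ↑ʳ j) ≡ true) → (∀ i j → M (m ↑ʳ i) (j ↑ˡ k) ≡ true) →
    all² (m + k) M ≡ all² m (λ i j → M (i ↑ˡ k) (j ↑ˡ k)) ∧ all² k (λ i j → M (m ↑ʳ i) (m ↑ʳ j))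
  all²-blockDiagonal upper lower =
    trans (all-allFin-+ m k _) (cong₂ _∧_ (all-cong rowˡ (allFin m)) (all-cong rowʳ (allFin k)))
    where
    rowˡ : ∀ i → all (M (i ↑ˡ k)) (allFin (m + k)) ≡ all (λ j → M (i ↑ˡ k) (j ↑ˡ k)) (allFin m)
    rowˡ i = trans (all-allFin-+ m k _)
      (trans (cong (all (λ j → M (i ↑ˡ k) (j ↑ˡ k)) (allFin m) ∧_) (all-true (upper i) (allFin k)))
             (∧-identityʳ _))
    rowʳ : ∀ i → all (M (m ↑ʳ i)) (allFin (m + k)) ≡ all (λ j → M (m ↑ʳ i) (m ↑ʳ j)) (allFin k)
    rowʳ i = trans (all-allFin-+ m k _)
      (cong (_∧ all (λ j → M (m ↑ʳ i) (m ↑ʳ j)) (allFin k)) (all-true (lower i) (allFin m)))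

-- Cycles of a permutation

iterates : ∀ {n} → ℕ → Map n → Fin n → List (Fin n)
iterates N g v = map (λ i → iter g i v) (upTo N)

iter-+ : ∀ {n} (g : Map n) i j v → iter g (i + j) v ≡ iter g i (iter g j v)
iter-+ g zero    j v = refl
iter-+ g (suc i) j v = cong g (iter-+ g i j v)

module _ {m : ℕ} (g : Map m) (v : Fin m) where

  iter-repeats : ∃₂ λ a b → a < b × b ≤ m × iter g a v ≡ iter g b v
  iter-repeats with i , j , i<j , eq ← pigeonhole ≤-refl (λ i → iter g (toℕ i) v) =
    toℕ i , toℕ j , i<j , ≤-pred (toℕ<n j) , eq

  iter-shorten : ∀ n → m ≤ n → ∃ λ n′ → n′ < n × iter g n v ≡ iter g n′ v
  iter-shorten n m≤n with a , b , a<b , b≤m , gᵃ≡gᵇ ← iter-repeats =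
    n ∸ b + a , subst (n ∸ b + a <_) (m∸n+n≡m b≤n) (+-monoʳ-< (n ∸ b) a<b) , shift
    where
    b≤n : b ≤ n
    b≤n = ≤-trans b≤m m≤n
    shift : iter g n v ≡ iter g (n ∸ b + a) v
    shift = begin
      iter g n v                  ≡⟨ cong (λ z → iter g z v) (sym (m∸n+n≡m b≤n)) ⟩
      iter g (n ∸ b + b) v        ≡⟨ iter-+ g (n ∸ b) b v ⟩
      iter g (n ∸ b) (iter g b v) ≡⟨ cong (iter g (n ∸ b)) (sym gᵃ≡gᵇ) ⟩
      iter g (n ∸ b) (iter g a v) ≡⟨ sym (iter-+ g (n ∸ b) a v) ⟩
      iter g (n ∸ b + a) v        ∎
      where open ≡-Reasoning

  iter-below : ∀ n → ∃ λ i → i < m × iter g n v ≡ iter g i v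
  iter-below = <-rec _ step
    where
    step : ∀ n → (∀ {n′} → n′ < n → ∃ λ i → i < m × iter g n′ v ≡ iter g i v) →
           ∃ λ i → i < m × iter g n v ≡ iter g i v
    step n rec with n <? m
    ... | yes n<m = n , n<m , refl
    ... | no n≮m with n′ , n′<n , eq ← iter-shorten n (≮⇒≥ n≮m)
                 with i , i<m , eq′ ← rec n′<n = i , i<m , trans eq eq′

  iterates-⊆-orbit : ∀ N → iterates N g v ⊆ orbit g v
  iterates-⊆-orbit N w∈ with n , _ , refl ← ∈-map⁻ (λ i → iter g i v) w∈ with i , i<m , eq ← iter-below n =
    subst (_∈ orbit g v) (sym eq) (∈-map⁺ (λ i → iter g i v) (∈-upTo⁺ i<m))

  orbit-⊆-iterates : ∀ {N} → m ≤ N → orbit g v ⊆ iterates N g v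
  orbit-⊆-iterates m≤N w∈ with n , n∈ , refl ← ∈-map⁻ (λ i → iter g i v) w∈ =
    ∈-map⁺ (λ i → iter g i v) (∈-upTo⁺ (<-≤-trans (∈-upTo⁻ n∈) m≤N))

  any-iterates : ∀ (p : Fin m → Bool) {N} → m ≤ N → any p (iterates N g v) ≡ any p (orbit g v)
  any-iterates p {N} m≤N =
    T-ext (any-resp-⊆ p (iterates-⊆-orbit N)) (any-resp-⊆ p (orbit-⊆-iterates m≤N))

  all-iterates : ∀ (p : Fin m → Bool) {N} → m ≤ N → all p (iterates N g v) ≡ all p (orbit g v)
  all-iterates p {N} m≤N =
    T-ext (all-resp-⊇ p (orbit-⊆-iterates m≤N)) (all-resp-⊇ p (iterates-⊆-orbit N))

module _ {m k : ℕ} (g : Map m) (h : Map k) where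

  ⊕M-↑ˡ : ∀ u → (g ⊕M h) (u ↑ˡ k) ≡ g u ↑ˡ k
  ⊕M-↑ˡ u rewrite splitAt-↑ˡ m u k = refl

  ⊕M-↑ʳ : ∀ u → (g ⊕M h) (m ↑ʳ u) ≡ m ↑ʳ h u
  ⊕M-↑ʳ u rewrite splitAt-↑ʳ m k u = refl

  iter-⊕M-↑ˡ : ∀ n u → iter (g ⊕M h) n (u ↑ˡ k) ≡ iter g n u ↑ˡ k
  iter-⊕M-↑ˡ zero    u = refl
  iter-⊕M-↑ˡ (suc n) u = trans (cong (g ⊕M h) (iter-⊕M-↑ˡ n u)) (⊕M-↑ˡ _)

  iter-⊕M-↑ʳ : ∀ n u → iter (g ⊕M h) n (m ↑ʳ u) ≡ m ↑ʳ iter h n u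
  iter-⊕M-↑ʳ zero    u = refl
  iter-⊕M-↑ʳ (suc n) u = trans (cong (g ⊕M h) (iter-⊕M-↑ʳ n u)) (⊕M-↑ʳ _)

  -- The orbit of g ⊕M h takes m + k iterates, that of g only m; any-iterates and all-iterates bridge the gap.
  orbit-⊕M-↑ˡ : ∀ u → orbit (g ⊕M h) (u ↑ˡ k) ≡ map (_↑ˡ k) (iterates (m + k) g u)
  orbit-⊕M-↑ˡ u = trans (map-cong (λ n → iter-⊕M-↑ˡ n u) (upTo (m + k))) (map-∘ (upTo (m + k)))

  orbit-⊕M-↑ʳ : ∀ u → orbit (g ⊕M h) (m ↑ʳ u) ≡ map (m ↑ʳ_) (iterates (m + k) h u)
  orbit-⊕M-↑ʳ u = trans (map-cong (λ n → iter-⊕M-↑ʳ n u) (upTo (m + k))) (map-∘ (upTo (m + k)))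

  any-orbit-⊕M-↑ˡ : ∀ p u → any p (orbit (g ⊕M h) (u ↑ˡ k)) ≡ any (p ∘ (_↑ˡ k)) (orbit g u)
  any-orbit-⊕M-↑ˡ p u = trans (cong (any p) (orbit-⊕M-↑ˡ u))
    (trans (any-map p _ (iterates (m + k) g u)) (any-iterates g u _ (m≤m+n m k)))

  any-orbit-⊕M-↑ʳ : ∀ p u → any p (orbit (g ⊕M h) (m ↑ʳ u)) ≡ any (p ∘ (m ↑ʳ_)) (orbit h u)
  any-orbit-⊕M-↑ʳ p u = trans (cong (any p) (orbit-⊕M-↑ʳ u))
    (trans (any-map p _ (iterates (m + k) h u)) (any-iterates h u _ (m≤n+m k m)))

  all-orbit-⊕M-↑ˡ : ∀ p u → all p (orbit (g ⊕M h) (u ↑ˡ k)) ≡ all (p ∘ (_↑ˡ k)) (orbit g u)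
  all-orbit-⊕M-↑ˡ p u = trans (cong (all p) (orbit-⊕M-↑ˡ u))
    (trans (all-map p _ (iterates (m + k) g u)) (all-iterates g u _ (m≤m+n m k)))

  all-orbit-⊕M-↑ʳ : ∀ p u → all p (orbit (g ⊕M h) (m ↑ʳ u)) ≡ all (p ∘ (m ↑ʳ_)) (orbit h u)
  all-orbit-⊕M-↑ʳ p u = trans (cong (all p) (orbit-⊕M-↑ʳ u))
    (trans (all-map p _ (iterates (m + k) h u)) (all-iterates h u _ (m≤n+m k m)))

  isRep-⊕M-↑ˡ : ∀ u → isRep (g ⊕M h) (u ↑ˡ k) ≡ isRep g u
  isRep-⊕M-↑ˡ u = trans (all-orbit-⊕M-↑ˡ _ u)
    (all-cong (λ w → cong₂ _≤ᵇ_ (toℕ-↑ˡ u k) (toℕ-↑ˡ w k)) (orbit g u))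

  isRep-⊕M-↑ʳ : ∀ u → isRep (g ⊕M h) (m ↑ʳ u) ≡ isRep h u
  isRep-⊕M-↑ʳ u = trans (all-orbit-⊕M-↑ʳ _ u)
    (all-cong (λ w → trans (cong₂ _≤ᵇ_ (toℕ-↑ʳ m u) (toℕ-↑ʳ m w)) (+-cancelˡ-≤ᵇ m _ _)) (orbit h u))

  reps-⊕M : reps (g ⊕M h) ≡ map (_↑ˡ k) (reps g) ++ map (m ↑ʳ_) (reps h)
  reps-⊕M = begin
    filterᵇ rep (allFin (m + k))
      ≡⟨ cong (filterᵇ rep) (allFin-+ m k) ⟩
    filterᵇ rep (map (_↑ˡ k) (allFin m) ++ map (m ↑ʳ_) (allFin k))
      ≡⟨ filter-++ (T? ∘ rep) (map (_↑ˡ k) (allFin m)) (map (m ↑ʳ_) (allFin k)) ⟩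
    filterᵇ rep (map (_↑ˡ k) (allFin m)) ++ filterᵇ rep (map (m ↑ʳ_) (allFin k))
      ≡⟨ cong₂ _++_ (filterᵇ-map rep _ (allFin m)) (filterᵇ-map rep _ (allFin k)) ⟩
    map (_↑ˡ k) (filterᵇ (rep ∘ (_↑ˡ k)) (allFin m)) ++ map (m ↑ʳ_) (filterᵇ (rep ∘ (m ↑ʳ_)) (allFin k))
      ≡⟨ cong₂ _++_ (cong (map (_↑ˡ k)) (filterᵇ-cong isRep-⊕M-↑ˡ (allFin m)))
                    (cong (map (m ↑ʳ_)) (filterᵇ-cong isRep-⊕M-↑ʳ (allFin k))) ⟩
    map (_↑ˡ k) (reps g) ++ map (m ↑ʳ_) (reps h) ∎
    where
    open ≡-Reasoning
    rep = isRep (g ⊕M h)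

  c-⊕M : c (g ⊕M h) ≡ c g + c h
  c-⊕M = trans (cong length reps-⊕M) (length-map-++ (_↑ˡ k) (m ↑ʳ_) (reps g) (reps h))

  inCycle-⊕M-↑ˡ↑ˡ : ∀ r u → inCycle (g ⊕M h) (r ↑ˡ k) (u ↑ˡ k) ≡ inCycle g r u
  inCycle-⊕M-↑ˡ↑ˡ r u = trans (any-orbit-⊕M-↑ˡ _ u)
    (any-cong (λ w → ⌊≟⌋-injective (_↑ˡ k) (↑ˡ-injective k) w r) (orbit g u))

  inCycle-⊕M-↑ʳ↑ʳ : ∀ r u → inCycle (g ⊕M h) (m ↑ʳ r) (m ↑ʳ u) ≡ inCycle h r u
  inCycle-⊕M-↑ʳ↑ʳ r u = trans (any-orbit-⊕M-↑ʳ _ u)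
    (any-cong (λ w → ⌊≟⌋-injective (m ↑ʳ_) (↑ʳ-injective m) w r) (orbit h u))

  inCycle-⊕M-↑ˡ↑ʳ : ∀ r u → inCycle (g ⊕M h) (r ↑ˡ k) (m ↑ʳ u) ≡ false
  inCycle-⊕M-↑ˡ↑ʳ r u = trans (any-orbit-⊕M-↑ʳ _ u)
    (any-false (λ w → ⌊≟⌋-false (↑ˡ≢↑ʳ r w ∘ sym)) (orbit h u))

  inCycle-⊕M-↑ʳ↑ˡ : ∀ r u → inCycle (g ⊕M h) (m ↑ʳ r) (u ↑ˡ k) ≡ false
  inCycle-⊕M-↑ʳ↑ˡ r u = trans (any-orbit-⊕M-↑ˡ _ u)
    (any-false (λ w → ⌊≟⌋-false (↑ˡ≢↑ʳ w r)) (orbit g u))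

-- Disjoint unions of graphs

_⊎G_ : ∀ {a b} → Graph a → Graph b → (Fin a ⊎ Fin b) → (Fin a ⊎ Fin b) → Bool
(A ⊎G B) (inj₁ i) (inj₁ j) = A i j
(A ⊎G B) (inj₂ i) (inj₂ j) = B i j
(A ⊎G B) (inj₁ _) (inj₂ _) = false
(A ⊎G B) (inj₂ _) (inj₁ _) = false

module _ {m k : ℕ} (A : Graph m) (B : Graph k) where

  ⊕G-splitAt : ∀ u v → (A ⊕G B) u v ≡ (A ⊎G B) (splitAt m u) (splitAt m v)
  ⊕G-splitAt u v with splitAt m u | splitAt m v
  ... | inj₁ _ | inj₁ _ = refl
  ... | inj₁ _ | inj₂ _ = refl
  ... | inj₂ _ | inj₁ _ = refl
  ... | inj₂ _ | inj₂ _ = refl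

  ⊕G-↑ˡ↑ˡ : ∀ i j → (A ⊕G B) (i ↑ˡ k) (j ↑ˡ k) ≡ A i j
  ⊕G-↑ˡ↑ˡ i j rewrite splitAt-↑ˡ m i k | splitAt-↑ˡ m j k = refl

  ⊕G-↑ʳ↑ʳ : ∀ i j → (A ⊕G B) (m ↑ʳ i) (m ↑ʳ j) ≡ B i j
  ⊕G-↑ʳ↑ʳ i j rewrite splitAt-↑ʳ m k i | splitAt-↑ʳ m k j = refl

  ⊕G-↑ˡ↑ʳ : ∀ i j → (A ⊕G B) (i ↑ˡ k) (m ↑ʳ j) ≡ false
  ⊕G-↑ˡ↑ʳ i j rewrite splitAt-↑ˡ m i k | splitAt-↑ʳ m k j = refl

  ⊕G-↑ʳ↑ˡ : ∀ i j → (A ⊕G B) (m ↑ʳ i) (j ↑ˡ k) ≡ false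
  ⊕G-↑ʳ↑ˡ i j rewrite splitAt-↑ʳ m k i | splitAt-↑ˡ m j k = refl

joined : ∀ {n} → Graph n → (Fin n → Bool) → (Fin n → Bool) → Bool
joined {n} Γ S T = any² n (λ u w → Γ u w ∧ S u ∧ T w)

module _ {n : ℕ} (Γ : Graph n) {S T : Fin n → Bool} where

  joined-cong : ∀ {S′ T′} → (∀ u → S u ≡ S′ u) → (∀ w → T w ≡ T′ w) → joined Γ S T ≡ joined Γ S′ T′
  joined-cong eS eT = any²-cong (λ u w → cong₂ (λ s t → Γ u w ∧ s ∧ t) (eS u) (eT w))

  joined-emptyˡ : (∀ u → S u ≡ false) → joined Γ S T ≡ false
  joined-emptyˡ e = any²-false (λ u w → trans (cong (λ s → Γ u w ∧ s ∧ T w) (e u)) (∧-zeroʳ (Γ u w)))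

  joined-emptyʳ : (∀ w → T w ≡ false) → joined Γ S T ≡ false
  joined-emptyʳ e = any²-false (λ u w →
    trans (cong (λ t → Γ u w ∧ S u ∧ t) (e w)) (trans (cong (Γ u w ∧_) (∧-zeroʳ (S u))) (∧-zeroʳ (Γ u w))))

joined-⊕G : ∀ {m k} (Γ : Graph m) (Δ : Graph k) (S T : Fin (m + k) → Bool) →
  joined (Γ ⊕G Δ) S T ≡ joined Γ (S ∘ (_↑ˡ k)) (T ∘ (_↑ˡ k)) ∨ joined Δ (S ∘ (m ↑ʳ_)) (T ∘ (m ↑ʳ_))
joined-⊕G {m} {k} Γ Δ S T =
  trans (any²-blockDiagonal m k _ (λ i j → cong (λ e → e ∧ S (i ↑ˡ k) ∧ T (m ↑ʳ j)) (⊕G-↑ˡ↑ʳ Γ Δ i j))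
                                  (λ i j → cong (λ e → e ∧ S (m ↑ʳ i) ∧ T (j ↑ˡ k)) (⊕G-↑ʳ↑ˡ Γ Δ i j)))
        (cong₂ _∨_ (any²-cong (λ i j → cong (λ e → e ∧ S (i ↑ˡ k) ∧ T (j ↑ˡ k)) (⊕G-↑ˡ↑ˡ Γ Δ i j)))
                   (any²-cong (λ i j → cong (λ e → e ∧ S (m ↑ʳ i) ∧ T (m ↑ʳ j)) (⊕G-↑ʳ↑ʳ Γ Δ i j))))

isProper-⊕G : ∀ {m k x} (A : Graph m) (B : Graph k) (u : Vec (Fin x) m) (v : Vec (Fin x) k) →
  isProper (A ⊕G B) (u Vec.++ v) ≡ isProper A u ∧ isProper B v
isProper-⊕G {m} {k} A B u v =
  trans (all²-blockDiagonal m k _ upper lower) (cong₂ _∧_ (all²-cong diagˡ) (all²-cong diagʳ))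
  where
  w = u Vec.++ v
  ok : ∀ {n} → Graph n → Vec (Fin _) n → Fin n → Fin n → Bool
  ok C f i j = not (C i j) ∨ not ⌊ Vec.lookup f i ≟ Vec.lookup f j ⌋
  upper : ∀ i j → ok (A ⊕G B) w (i ↑ˡ k) (m ↑ʳ j) ≡ true
  upper i j rewrite ⊕G-↑ˡ↑ʳ A B i j = refl
  lower : ∀ i j → ok (A ⊕G B) w (m ↑ʳ i) (j ↑ˡ k) ≡ true
  lower i j rewrite ⊕G-↑ʳ↑ˡ A B i j = refl
  diagˡ : ∀ i j → ok (A ⊕G B) w (i ↑ˡ k) (j ↑ˡ k) ≡ ok A u i j
  diagˡ i j rewrite ⊕G-↑ˡ↑ˡ A B i j | lookup-++ˡ u v i | lookup-++ˡ u v j = refl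
  diagʳ : ∀ i j → ok (A ⊕G B) w (m ↑ʳ i) (m ↑ʳ j) ≡ ok B v i j
  diagʳ i j rewrite ⊕G-↑ʳ↑ʳ A B i j | lookup-++ʳ u v i | lookup-++ʳ u v j = refl

open SemiringSum ℕ.+-*-semiring using () renaming (Σ-map-*ʳ to sum-map-*ʳ; Σ-cartesian to sum-cartesian)

count-extendColourings : ∀ {m x} (p : Vec (Fin x) (suc m) → Bool) →
  count p (allColourings (suc m) x) ≡ sum (map (λ a → count (p ∘ (a Vec.∷_)) (allColourings m x)) (allFin x))
count-extendColourings {m} {x} p = trans (count-concatMap p _ (allFin x))
  (cong sum (map-cong (λ a → count-map p (a Vec.∷_) (allColourings m x)) (allFin x)))

count-allColourings-++ : ∀ m {k x} (p : Vec (Fin x) (m + k) → Bool) pa pb →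
  (∀ u v → p (u Vec.++ v) ≡ pa u ∧ pb v) →
  count p (allColourings (m + k) x) ≡ count pa (allColourings m x) * count pb (allColourings k x)
count-allColourings-++ zero {k} {x} p pa pb split =
  trans (count-cong (split Vec.[]) (allColourings k x)) (count-const-∧ pa Vec.[] pb (allColourings k x))
count-allColourings-++ (suc m) {k} {x} p pa pb split = begin
  count p (allColourings (suc m + k) x)
    ≡⟨ count-extendColourings p ⟩
  sum (map (λ a → count (p ∘ (a Vec.∷_)) (allColourings (m + k) x)) (allFin x))
    ≡⟨ cong sum (map-cong (λ a → count-allColourings-++ m (p ∘ (a Vec.∷_)) (pa ∘ (a Vec.∷_)) pb
                                   (λ u v → split (a Vec.∷ u) v)) (allFin x)) ⟩
  sum (map (λ a → count (pa ∘ (a Vec.∷_)) (allColourings m x) * count pb (allColourings k x)) (allFin x))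
    ≡⟨ sum-map-*ʳ _ (λ a → count (pa ∘ (a Vec.∷_)) (allColourings m x)) (allFin x) ⟩
  sum (map (λ a → count (pa ∘ (a Vec.∷_)) (allColourings m x)) (allFin x)) * count pb (allColourings k x)
    ≡⟨ cong (_* count pb (allColourings k x)) (count-extendColourings pa) ⟨
  count pa (allColourings (suc m) x) * count pb (allColourings k x) ∎
  where open ≡-Reasoning

chrom-⊕G : ∀ {m k} (A : Graph m) (B : Graph k) x → chrom (A ⊕G B) x ≡ chrom A x * chrom B x
chrom-⊕G {m} A B x = count-allColourings-++ m (isProper (A ⊕G B)) (isProper A) (isProper B) (isProper-⊕G A B)

chrom-cong : ∀ {n} {A B : Graph n} → (∀ i j → A i j ≡ B i j) → ∀ x → chrom A x ≡ chrom B x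
chrom-cong {n} e x = count-cong (λ f → all²-cong (λ i j → cong (λ a → not a ∨ _) (e i j))) (allColourings n x)

chrom-cast : ∀ {n n′} (eq : n ≡ n′) {A : Graph n} {B : Graph n′} →
  (∀ i j → A i j ≡ B (cast eq i) (cast eq j)) → ∀ x → chrom A x ≡ chrom B x
chrom-cast refl {B = B} e = chrom-cong (λ i j → trans (e i j) (cong₂ B (cast-is-id refl i) (cast-is-id refl j)))

-- The quotient graph with its cycles indexed by a list of chosen vertices; quotient Γ g = quotientAt Γ g (reps g).
quotientAt : ∀ {n} → Graph n → Map n → (rs : List (Fin n)) → Graph (length rs)
quotientAt Γ g rs i j = joined Γ (inCycle g (lookup rs i)) (inCycle g (lookup rs j))

module _ {m k : ℕ} (Γ : Graph m) (Δ : Graph k) (g : Map m) (h : Map k) (rs : List (Fin m)) (ss : List (Fin k)) where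

  rep : Fin (length rs) ⊎ Fin (length ss) → Fin (m + k)
  rep = [ (_↑ˡ k) ∘ lookup rs , (m ↑ʳ_) ∘ lookup ss ]′

  cycle : Fin (length rs) ⊎ Fin (length ss) → Fin (m + k) → Bool
  cycle s = inCycle (g ⊕M h) (rep s)

  joined-cycles-⊕ : ∀ s t → joined (Γ ⊕G Δ) (cycle s) (cycle t) ≡ (quotientAt Γ g rs ⊎G quotientAt Δ h ss) s t
  joined-cycles-⊕ s t = trans (joined-⊕G Γ Δ (cycle s) (cycle t)) (blocks s t)
    where
    blocks : ∀ s t →
      joined Γ (cycle s ∘ (_↑ˡ k)) (cycle t ∘ (_↑ˡ k)) ∨ joined Δ (cycle s ∘ (m ↑ʳ_)) (cycle t ∘ (m ↑ʳ_))
      ≡ (quotientAt Γ g rs ⊎G quotientAt Δ h ss) s t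
    blocks (inj₁ a) (inj₁ b) = trans (cong₂ _∨_
      (joined-cong Γ (inCycle-⊕M-↑ˡ↑ˡ g h (lookup rs a)) (inCycle-⊕M-↑ˡ↑ˡ g h (lookup rs b)))
      (joined-emptyˡ Δ (inCycle-⊕M-↑ˡ↑ʳ g h (lookup rs a)))) (∨-identityʳ _)
    blocks (inj₂ a) (inj₂ b) = cong₂ _∨_
      (joined-emptyˡ Γ (inCycle-⊕M-↑ʳ↑ˡ g h (lookup ss a)))
      (joined-cong Δ (inCycle-⊕M-↑ʳ↑ʳ g h (lookup ss a)) (inCycle-⊕M-↑ʳ↑ʳ g h (lookup ss b)))
    blocks (inj₁ a) (inj₂ b) = cong₂ _∨_
      (joined-emptyʳ Γ (inCycle-⊕M-↑ʳ↑ˡ g h (lookup ss b)))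
      (joined-emptyˡ Δ (inCycle-⊕M-↑ˡ↑ʳ g h (lookup rs a)))
    blocks (inj₂ a) (inj₁ b) = cong₂ _∨_
      (joined-emptyˡ Γ (inCycle-⊕M-↑ʳ↑ˡ g h (lookup ss a)))
      (joined-emptyʳ Δ (inCycle-⊕M-↑ˡ↑ʳ g h (lookup rs b)))

  length-⊕ : length (map (_↑ˡ k) rs ++ map (m ↑ʳ_) ss) ≡ length rs + length ss
  length-⊕ = length-map-++ (_↑ˡ k) (m ↑ʳ_) rs ss

  quotientAt-⊕ : ∀ i j →
    quotientAt (Γ ⊕G Δ) (g ⊕M h) (map (_↑ˡ k) rs ++ map (m ↑ʳ_) ss) i j
    ≡ (quotientAt Γ g rs ⊕G quotientAt Δ h ss) (cast length-⊕ i) (cast length-⊕ j)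
  quotientAt-⊕ i j = begin
    joined (Γ ⊕G Δ) (inCycle (g ⊕M h) (lookup vs i)) (inCycle (g ⊕M h) (lookup vs j))
      ≡⟨ cong₂ (λ r r′ → joined (Γ ⊕G Δ) (inCycle (g ⊕M h) r) (inCycle (g ⊕M h) r′))
               (lookup-map-++ (_↑ˡ k) (m ↑ʳ_) rs ss i) (lookup-map-++ (_↑ˡ k) (m ↑ʳ_) rs ss j) ⟩
    joined (Γ ⊕G Δ) (cycle (splitAt _ (cast length-⊕ i))) (cycle (splitAt _ (cast length-⊕ j)))
      ≡⟨ joined-cycles-⊕ (splitAt _ (cast length-⊕ i)) (splitAt _ (cast length-⊕ j)) ⟩
    (quotientAt Γ g rs ⊎G quotientAt Δ h ss) (splitAt _ (cast length-⊕ i)) (splitAt _ (cast length-⊕ j))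
      ≡⟨ ⊕G-splitAt (quotientAt Γ g rs) (quotientAt Δ h ss) (cast length-⊕ i) (cast length-⊕ j) ⟨
    (quotientAt Γ g rs ⊕G quotientAt Δ h ss) (cast length-⊕ i) (cast length-⊕ j) ∎
    where
    open ≡-Reasoning
    vs = map (_↑ˡ k) rs ++ map (m ↑ʳ_) ss

chrom-quotient-⊕ : ∀ {m k} (Γ : Graph m) (Δ : Graph k) g h x →
  chrom (quotient (Γ ⊕G Δ) (g ⊕M h)) x ≡ chrom (quotient Γ g) x * chrom (quotient Δ h) x
chrom-quotient-⊕ {m} {k} Γ Δ g h x = begin
  chrom (quotientAt (Γ ⊕G Δ) (g ⊕M h) (reps (g ⊕M h))) x
    ≡⟨ cong (λ rs → chrom (quotientAt (Γ ⊕G Δ) (g ⊕M h) rs) x) (reps-⊕M g h) ⟩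
  chrom (quotientAt (Γ ⊕G Δ) (g ⊕M h) (map (_↑ˡ k) (reps g) ++ map (m ↑ʳ_) (reps h))) x
    ≡⟨ chrom-cast (length-⊕ Γ Δ g h (reps g) (reps h)) (quotientAt-⊕ Γ Δ g h (reps g) (reps h)) x ⟩
  chrom (quotient Γ g ⊕G quotient Δ h) x
    ≡⟨ chrom-⊕G (quotient Γ g) (quotient Δ h) x ⟩
  chrom (quotient Γ g) x * chrom (quotient Δ h) x ∎
  where open ≡-Reasoning

-- The polynomials P and F

P-⊕ : ∀ {m k} (Γ : Graph m) (Δ : Graph k) G H x → P (Γ ⊕G Δ) (G ⊗ H) x ≡ P Γ G x * P Δ H x
P-⊕ Γ Δ G H x =
  sum-cartesian _⊕M_ (λ f → chrom (quotient (Γ ⊕G Δ) f) x) _ _ (λ g h → chrom-quotient-⊕ Γ Δ g h x) G H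

open SemiringSum ℤ.+-*-semiring using () renaming (Σ to Σℤ; Σ-cartesian to Σℤ-cartesian)

F-Σ : ∀ {n} (G : List (Map n)) y → F G y ≡ Σℤ (map (λ g → y ℤ.^ c g) G)
F-Σ []      y = refl
F-Σ (g ∷ G) y = cong (λ s → y ℤ.^ c g ℤ.+ s) (F-Σ G y)

F-⊗ : ∀ {m k} (G : List (Map m)) (H : List (Map k)) y → F (G ⊗ H) y ≡ F G y ℤ.* F H y
F-⊗ G H y = begin
  F (G ⊗ H) y
    ≡⟨ F-Σ (G ⊗ H) y ⟩
  Σℤ (map (λ f → y ℤ.^ c f) (G ⊗ H))
    ≡⟨ Σℤ-cartesian _⊕M_ _ _ _ (λ g h → trans (cong (y ℤ.^_) (c-⊕M g h)) (ℤ.^-distribˡ-+-* y (c g) (c h))) G H ⟩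
  Σℤ (map (λ g → y ℤ.^ c g) G) ℤ.* Σℤ (map (λ h → y ℤ.^ c h) H)
    ≡⟨ cong₂ ℤ._*_ (F-Σ G y) (F-Σ H y) ⟨
  F G y ℤ.* F H y ∎
  where open ≡-Reasoning

reciprocal-⊕ : ∀ {m k} (Γ : Graph m) (Δ : Graph k) G H →
  Reciprocal Γ G → Reciprocal Δ H → Reciprocal (Γ ⊕G Δ) (G ⊗ H)
reciprocal-⊕ {m} {k} Γ Δ G H recΓ recΔ x = begin
  ℤ.+ P (Γ ⊕G Δ) (G ⊗ H) x
    ≡⟨ cong ℤ.+_ (P-⊕ Γ Δ G H x) ⟩
  ℤ.+ (P Γ G x * P Δ H x)
    ≡⟨ ℤ.pos-* (P Γ G x) (P Δ H x) ⟩
  ℤ.+ P Γ G x ℤ.* ℤ.+ P Δ H x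
    ≡⟨ cong₂ ℤ._*_ (recΓ x) (recΔ x) ⟩
  (-1ℤ ℤ.^ m ℤ.* F G y) ℤ.* (-1ℤ ℤ.^ k ℤ.* F H y)
    ≡⟨ interchange (-1ℤ ℤ.^ m) (F G y) (-1ℤ ℤ.^ k) (F H y) ⟩
  (-1ℤ ℤ.^ m ℤ.* -1ℤ ℤ.^ k) ℤ.* (F G y ℤ.* F H y)
    ≡⟨ cong₂ ℤ._*_ (ℤ.^-distribˡ-+-* -1ℤ m k) (F-⊗ G H y) ⟨
  -1ℤ ℤ.^ (m + k) ℤ.* F (G ⊗ H) y ∎
  where
  open ≡-Reasoning
  y = ℤ.- ℤ.+ x

P-union : ∀ Cs x → P (graph (union Cs)) (group (union Cs)) x ≡ product (map (λ C → P (graph C) (group C) x) Cs)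
P-union []       x = refl
P-union (C ∷ Cs) x =
  trans (P-⊕ (graph C) (graph (union Cs)) (group C) (group (union Cs)) x) (cong (P (graph C) (group C) x *_) (P-union Cs x))

reciprocal-union : ∀ Cs → All (λ C → Reciprocal (graph C) (group C)) Cs → Reciprocal (graph (union Cs)) (group (union Cs))
reciprocal-union []       []           x = refl
reciprocal-union (C ∷ Cs) (recC ∷ recs) =
  reciprocal-⊕ (graph C) (graph (union Cs)) (group C) (group (union Cs)) recC (reciprocal-union Cs recs)

mainTheorem13 : (Cs : List Comp)
    → All (λ C → IsSimple (graph C) × IsAutSubgroup (graph C) (group C)) Cs
    → ((x : ℕ) → P (graph (union Cs)) (group (union Cs)) x
                   ≡ product (map (λ C → P (graph C) (group C) x) Cs))
      × (All (λ C → Reciprocal (graph C) (group C)) Cs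
         → Reciprocal (graph (union Cs)) (group (union Cs)))
mainTheorem13 Cs _ = P-union Cs , reciprocal-union Cs
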